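{- Let $G=(V,E)$ be an undirected graph, $s\neq t\in V$, and let $Q_1,\dots,Q_r$ with $r\ge1$ be vertex-disjoint simple $s$---$t$ paths in $G$. There is an augmenting path in $G$ (with respect to $Q_1,\dots,Q_r$) if and only if $s$ and $t$ are strongly connected in $G_{res}$.
   Context: Build the directed network $N$: vertices $s,t$, and for each $v\in V\setminus\{s,t\}$ two vertices $v_{in},v_{out}$ with an arc $(v_{in},v_{out})$; for each edge $\{u,v\}\in E$ add arcs $(u_{out},v_{in})$ and $(v_{out},u_{in})$, where by convention $s_{in}=s_{out}=s$ and $t_{in}=t_{out}=t$. All arcs have capacity 1. The paths $Q_1,\dots,Q_r$ define a unit flow in $N$ (each $Q_j=s,u_1,\dots,u_m,t$ uses arcs $(s,u_{1,in}),(u_{1,in},u_{1,out}),(u_{1,out},u_{2,in}),\dots,(u_{m,out},t)$). $G'_{res}$ is the Ford–Fulkerson residual graph of $N$ with respect to this flow: it contains every arc of $N$ not carrying flow, and the reversal of every arc carrying flow. An augmenting path in $G$ (with respect to $Q_1,\dots,Q_r$) is a directed $s\to t$ path in $G'_{res}$. The graph $G_{res}$ is obtained from $G'_{res}$ by contracting, for each $v\in V\setminus\{s,t\}$ not lying on any of $Q_1,\dots,Q_r$, the two vertices $v_{in},v_{out}$ into a single vertex $v$. -}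

module Defs where

open import Data.Nat using (ℕ)
open import Data.Fin using (Fin; _≟_)
open import Data.Bool using (Bool; true; false; if_then_else_; _∨_)
open import Data.List using (List; []; _∷_; head; last)
open import Data.Bool.ListAction using (any)
open import Data.List.Membership.Propositional using (_∈_)
open import Data.List.Relation.Unary.Unique.Propositional using (Unique)
open import Data.List.Relation.Unary.Linked using (Linked)
open import Data.Maybe using (just)
open import Data.Product using (Σ; ∃; ∃₂; _×_; _,_)
open import Data.Sum using (_⊎_)
open import Relation.Binary.PropositionalEquality using (_≡_; _≢_)
open import Relation.Nullary using (¬_)
open import Relation.Nullary.Decidable using (⌊_⌋)
open import Relation.Binary.Construct.Closure.ReflexiveTransitive using (Star)
open import Data.List.Base using () renaming (allFin to allFinL)

record Graph (n : ℕ) : Set where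
  field
    adj   : Fin n → Fin n → Bool
    sym   : ∀ u v → adj u v ≡ adj v u
    irref : ∀ v → adj v v ≡ false
open Graph public

record SimplePath {n : ℕ} (G : Graph n) (s t : Fin n) (P : List (Fin n)) : Set where
  field
    starts : head P ≡ just s
    ends   : last P ≡ just t
    edges  : Linked (λ u v → adj G u v ≡ true) P
    simple : Unique P

data Consec {A : Set} (x y : A) : List A → Set where
  here  : ∀ {xs} → Consec x y (x ∷ y ∷ xs)
  there : ∀ {z xs} → Consec x y xs → Consec x y (z ∷ xs)

module Network {n : ℕ} (G : Graph n) (s t : Fin n) {r : ℕ} (Q : Fin r → List (Fin n)) where

  -- vertices of N: (v , false) = v_in, (v , true) = v_out;
  -- s and t are represented by (s , true), (t , true)  (s_in = s_out = s);
  -- the nodes (s , false), (t , false) are unused isolated dummies.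
  Node : Set
  Node = Fin n × Bool

  isST : Fin n → Bool
  isST v = ⌊ v ≟ s ⌋ ∨ ⌊ v ≟ t ⌋

  inN : Fin n → Node
  inN v = if isST v then (v , true) else (v , false)

  outN : Fin n → Node
  outN v = (v , true)

  sN tN : Node
  sN = outN s
  tN = outN t

  -- arcs of N (all of capacity 1)
  data Arc : Node → Node → Set where
    split : ∀ v → v ≢ s → v ≢ t → Arc (v , false) (v , true)
    edge  : ∀ u v → adj G u v ≡ true → Arc (outN u) (inN v)

  expand : List (Fin n) → List Node
  expand []       = []
  expand (v ∷ vs) = if isST v then outN v ∷ expand vs
                    else inN v ∷ outN v ∷ expand vs

  -- arcs carrying flow of the unit flow defined by Q₁ … Q_r
  Flow : Node → Node → Set
  Flow x y = ∃ λ j → Consec x y (expand (Q j))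

  Res' : Node → Node → Set
  Res' x y = (Arc x y × ¬ Flow x y) ⊎ Flow y x

  AugmentingPath : Set
  AugmentingPath = Star Res' sN tN

  onQ : Fin n → Bool
  onQ v = any (λ j → any (λ w → ⌊ w ≟ v ⌋) (Q j)) (allFinL r)

  -- contraction map: v_in, v_out identified (with representative v_out)
  -- for every v ∉ {s,t} not lying on any Q_j
  π : Node → Node
  π (v , b) = if isST v ∨ onQ v then (v , b) else (v , true)

  -- arcs of G_res (the contracted graph, vertex set = image of π)
  Res : Node → Node → Set
  Res a b = ∃₂ λ x y → Res' x y × π x ≡ a × π y ≡ b

  StronglyConnectedInRes : Node → Node → Set
  StronglyConnectedInRes a b = Star Res a b × Star Res b a

-- Contraction only merges the two copies v_in, v_out of a vertex v ∉ {s, t}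
-- that carries no flow.  For such v the residual graph contains the arc
-- v_in → v_out, and it is the only arc leaving v_in; hence every path of
-- G_res lifts to a path of G'_res, and since s and t are not merged with
-- anything, an s → t path of G_res is an augmenting path.  Conversely an
-- augmenting path projects to an s → t path of G_res, and the reversal of
-- any flow path Q_j is a t → s path of the residual graph.
module Submission where

open import Defs hiding (sym)
open import Data.Nat using (ℕ; suc)
open import Data.Fin using (Fin; _≟_) renaming (zero to fzero)
open import Data.Bool using (true; false; _∨_)
open import Data.Bool.Properties using (∨-zeroʳ; T-≡)
open import Data.List using (List; []; _∷_; head; last)
open import Data.List.Membership.Propositional using (_∈_; lose)
open import Data.List.Membership.Propositional.Properties using (∈-allFin)
open import Data.List.Relation.Unary.Any using (here; there)
open import Data.List.Relation.Unary.Any.Properties using (any⁺)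
open import Data.Maybe using (just)
open import Data.Product using (∃; ∃₂; _×_; _,_; proj₁; proj₂)
open import Data.Sum using (_⊎_; inj₁; inj₂)
open import Data.Empty using (⊥-elim)
open import Function using (_∘_; case_of_)
open import Function.Bundles using (_⇔_; mk⇔; Equivalence)
open import Relation.Binary.PropositionalEquality using (_≡_; _≢_; refl; sym; trans; cong; subst; subst₂)
open import Relation.Nullary using (¬_; yes; no)
open import Relation.Nullary.Decidable using (fromWitness)
open import Relation.Binary.Construct.Closure.ReflexiveTransitive using (Star; ε; _◅_; _◅◅_; gmap)

Image : {A B : Set} → (A → A → Set) → (A → B) → B → B → Set
Image R f a b = ∃₂ λ x y → R x y × f x ≡ a × f y ≡ b

module _ {A B : Set} {R : A → A → Set} (f : A → B) where

  Star-image : ∀ {x y} → Star R x y → Star (Image R f) (f x) (f y)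
  Star-image = gmap f (λ r → _ , _ , r , refl , refl)

  StepLifting : Set
  StepLifting = ∀ {c x y} → f c ≡ f x → R x y → ∃ λ d → f d ≡ f y × Star R c d

  Star-lift : StepLifting → ∀ {a b c} → Star (Image R f) a b → f c ≡ a →
              ∃ λ d → f d ≡ b × Star R c d
  Star-lift lift ε fc≡a = _ , fc≡a , ε
  Star-lift lift ((x , y , r , fx≡a , fy≡b) ◅ rs) fc≡a
    with lift (trans fc≡a (sym fx≡a)) r
  ... | d , fd≡fy , c→d with Star-lift lift rs (trans fd≡fy fy≡b)
  ...   | e , fe≡b , d→e = e , fe≡b , c→d ◅◅ d→e

module _ {A : Set} where

  Consec⇒∈ˡ : ∀ {a b : A} {xs} → Consec a b xs → a ∈ xs
  Consec⇒∈ˡ here      = here refl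
  Consec⇒∈ˡ (there c) = there (Consec⇒∈ˡ c)

  Consec⇒∈ʳ : ∀ {a b : A} {xs} → Consec a b xs → b ∈ xs
  Consec⇒∈ʳ here      = there (here refl)
  Consec⇒∈ʳ (there c) = there (Consec⇒∈ʳ c)

  last-∷ : ∀ (x : A) xs {z} → last xs ≡ just z → last (x ∷ xs) ≡ just z
  last-∷ x (_ ∷ _) e = e

  Star-reverse : ∀ {R : A → A → Set} {xs x z} → head xs ≡ just x → last xs ≡ just z →
                 (∀ {a b} → Consec a b xs → R b a) → Star R z x
  Star-reverse {xs = _ ∷ []}     refl refl _   = ε
  Star-reverse {xs = _ ∷ _ ∷ _} refl e    rev = Star-reverse refl e (rev ∘ there) ◅◅ (rev here ◅ ε)

module ResidualPaths {n} (G : Graph n) (s t : Fin n) {r : ℕ} (Q : Fin r → List (Fin n)) where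
  open Network G s t Q

  Contracted : Fin n → Set
  Contracted v = isST v ≡ false × onQ v ≡ false

  isST-s : isST s ≡ true
  isST-s with s ≟ s
  ... | yes _   = refl
  ... | no s≢s = ⊥-elim (s≢s refl)

  isST-t : isST t ≡ true
  isST-t with t ≟ t
  ... | yes _   = ∨-zeroʳ _
  ... | no t≢t = ⊥-elim (t≢t refl)

  isST-false⇒ : ∀ {v} → isST v ≡ false → v ≢ s × v ≢ t
  isST-false⇒ e = (λ { refl → case trans (sym isST-s) e of λ () })
                , (λ { refl → case trans (sym isST-t) e of λ () })

  onQ-∈ : ∀ {w} j → w ∈ Q j → onQ w ≡ true
  onQ-∈ j w∈Qj = Equivalence.to T-≡
    (any⁺ _ (lose (∈-allFin j) (any⁺ _ (lose w∈Qj (fromWitness refl)))))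

  expand-∈ : ∀ L {w b} → (w , b) ∈ expand L → w ∈ L
  expand-∈ (v ∷ vs) m with isST v | m
  ... | true  | here refl           = here refl
  ... | true  | there m′            = there (expand-∈ vs m′)
  ... | false | here refl           = here refl
  ... | false | there (here refl)   = here refl
  ... | false | there (there m′)    = there (expand-∈ vs m′)

  Contracted⇒∉ : ∀ {v b} j → Contracted v → ¬ (v , b) ∈ expand (Q j)
  Contracted⇒∉ j (_ , offQ) m = case trans (sym (onQ-∈ j (expand-∈ (Q j) m))) offQ of λ ()

  head-expand : ∀ {L} → head L ≡ just s → head (expand L) ≡ just sN
  head-expand {_ ∷ _} refl rewrite isST-s = refl

  last-expand : ∀ L {z} → last L ≡ just z → last (expand L) ≡ just (outN z)
  last-expand (v ∷ []) refl with isST v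
  ... | true  = refl
  ... | false = refl
  last-expand (v ∷ w ∷ ws) e with isST v | last-expand (w ∷ ws) e
  ... | true  | ih = last-∷ (outN v) (expand (w ∷ ws)) ih
  ... | false | ih = last-∷ (v , false) (outN v ∷ expand (w ∷ ws)) (last-∷ (outN v) (expand (w ∷ ws)) ih)

  π-outN : ∀ v → π (outN v) ≡ outN v
  π-outN v with isST v ∨ onQ v
  ... | true  = refl
  ... | false = refl

  π-vertex : ∀ {x y} → π x ≡ π y → proj₁ x ≡ proj₁ y
  π-vertex {x} {y} eq = trans (sym (proj₁-π x)) (trans (cong proj₁ eq) (proj₁-π y))
    where
      proj₁-π : ∀ x → proj₁ (π x) ≡ proj₁ x
      proj₁-π (v , b) with isST v ∨ onQ v
      ... | true  = refl
      ... | false = refl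

  π-merged⇒Contracted : ∀ {v} → π (v , false) ≡ π (v , true) → Contracted v
  π-merged⇒Contracted {v} eq with isST v | onQ v | eq
  ... | false | false | _  = refl , refl
  ... | true  | _     | ()
  ... | false | true  | ()

  π⁻¹-tN : ∀ {d} → π d ≡ tN → d ≡ tN
  π⁻¹-tN eq with π-vertex (trans eq (sym (π-outN t)))
  π⁻¹-tN {_ , true}  eq | refl = refl
  π⁻¹-tN {_ , false} eq | refl rewrite isST-t = case eq of λ ()

  split-residual : ∀ {v} → Contracted v → Res' (v , false) (v , true)
  split-residual cv@(notST , _) =
    inj₁ (split _ v≢s v≢t , λ (j , c) → Contracted⇒∉ j cv (Consec⇒∈ˡ c))
    where v≢s = proj₁ (isST-false⇒ notST)
          v≢t = proj₂ (isST-false⇒ notST)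

  residual-from-in : ∀ {v y} → Contracted v → Res' (v , false) y → y ≡ (v , true)
  residual-from-in _  (inj₁ (split _ _ _ , _)) = refl
  residual-from-in cv (inj₂ (j , c))            = ⊥-elim (Contracted⇒∉ j cv (Consec⇒∈ʳ c))

  π-lifts-steps : StepLifting π
  π-lifts-steps {_ , b} {v , b′} eq rxy with π-vertex eq
  ... | refl = within b b′ eq rxy
    where
      within : ∀ b b′ {y} → π (v , b) ≡ π (v , b′) → Res' (v , b′) y →
               ∃ λ d → π d ≡ π y × Star Res' (v , b) d
      within false false _  rxy = _ , refl , rxy ◅ ε
      within true  true  _  rxy = _ , refl , rxy ◅ ε
      within false true  eq rxy = _ , refl , split-residual (π-merged⇒Contracted eq) ◅ rxy ◅ ε
      within true  false eq rxy =
        _ , cong π (sym (residual-from-in (π-merged⇒Contracted (sym eq)) rxy)) , ε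

  augmenting⇒s⇝t : AugmentingPath → Star Res sN tN
  augmenting⇒s⇝t p = subst₂ (Star Res) (π-outN s) (π-outN t) (Star-image π p)

  s⇝t⇒augmenting : Star Res sN tN → AugmentingPath
  s⇝t⇒augmenting p with Star-lift π π-lifts-steps p (π-outN s)
  ... | d , πd≡tN , sN⇝d = subst (Star Res' sN) (π⁻¹-tN πd≡tN) sN⇝d

  flow-path⇒t⇝s : ∀ j → SimplePath G s t (Q j) → Star Res tN sN
  flow-path⇒t⇝s j Qj = subst₂ (Star Res) (π-outN t) (π-outN s) (Star-image π reversed)
    where
      reversed : Star Res' tN sN
      reversed = Star-reverse (head-expand {Q j} (SimplePath.starts Qj))
                              (last-expand (Q j) (SimplePath.ends Qj))
                              (λ c → inj₂ (j , c))

corollary16 : ∀ {n} (G : Graph n) (s t : Fin n) → s ≢ t →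
    ∀ (r : ℕ) → (Q : Fin (suc r) → List (Fin n)) →
    (∀ j → SimplePath G s t (Q j)) →
    (∀ i j → i ≢ j → Q i ≢ Q j) →
    (∀ i j → i ≢ j → ∀ v → v ∈ Q i → v ∈ Q j → v ≡ s ⊎ v ≡ t) →
    (Network.AugmentingPath G s t Q
      ⇔ Network.StronglyConnectedInRes G s t Q (Network.sN G s t Q) (Network.tN G s t Q))
corollary16 G s t _ r Q paths _ _ =
  mk⇔ (λ p → augmenting⇒s⇝t p , flow-path⇒t⇝s fzero (paths fzero))
      (s⇝t⇒augmenting ∘ proj₁)
  where open ResidualPaths G s t Q
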